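{- Up to automorphisms of $\Delta$, there are at least two $K_2$-quasiperfect dominating sets $S$ in $\Delta$ for which $\Gamma(S)$ contains three pairwise adjacent vertices of pairwise different types $1$, $2$ and $3$.
   Context: $\Delta$ denotes the triangular lattice graph: its vertex set is $\{(x_1,x_2,x_3)\in\mathbb{Z}^3 : x_1+x_2+x_3=0\}$, and two vertices are adjacent iff their difference is one of $\pm(1,-1,0),\pm(1,0,-1),\pm(0,1,-1)$. A vertex subset $S$ is a quasiperfect dominating set (QPDS) if every vertex not in $S$ is adjacent to either one or two vertices of $S$; it is a $K_2$-QPDS if every connected component of $\Delta[S]$ is a single edge. A component $\{u,v\}$ has type $i\in\{1,2,3\}$ if $u$ and $v$ share the $i$-th coordinate $x_i$. $\Gamma(S)$ is the graph whose vertices are the components of $\Delta[S]$, two components being adjacent iff their graph distance in $\Delta$ (minimum distance between a vertex of one and a vertex of the other) is $3$. "At least two up to automorphisms" means at least two such sets, no one of which is the image of another under an automorphism of $\Delta$. -}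

module Defs where

open import Data.Nat using (ℕ; zero; suc; _≤_)
open import Data.Integer using (ℤ; _+_; _-_; 0ℤ; 1ℤ; -1ℤ)
open import Data.Bool using (Bool; true; false)
open import Data.Product using (Σ; _×_; _,_; ∃-syntax)
open import Data.Sum using (_⊎_)
open import Data.List using (List; _∷_; [])
open import Data.List.Membership.Propositional using (_∈_)
open import Relation.Binary.PropositionalEquality using (_≡_)
open import Relation.Nullary using (¬_)

-- Vertices of the triangular lattice Δ: (x₁,x₂,x₃) ∈ ℤ³ with x₁+x₂+x₃ = 0.
record V : Set where
  constructor vtx
  field
    x₁ x₂ x₃ : ℤ
    sum0     : x₁ + x₂ + x₃ ≡ 0ℤ
open V public

dirs : List (ℤ × ℤ × ℤ)
dirs = (1ℤ , -1ℤ , 0ℤ) ∷ (-1ℤ , 1ℤ , 0ℤ)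
     ∷ (1ℤ , 0ℤ , -1ℤ) ∷ (-1ℤ , 0ℤ , 1ℤ)
     ∷ (0ℤ , 1ℤ , -1ℤ) ∷ (0ℤ , -1ℤ , 1ℤ) ∷ []

Adj : V → V → Set
Adj a b = (x₁ b - x₁ a , x₂ b - x₂ a , x₃ b - x₃ a) ∈ dirs

Subset : Set
Subset = V → Bool

IsQPDS : Subset → Set
IsQPDS S = ∀ v → S v ≡ false →
    (∃[ u ] (Adj v u × S u ≡ true))
  × ¬ (∃[ u₁ ] ∃[ u₂ ] ∃[ u₃ ]
        ( ¬ u₁ ≡ u₂ × ¬ u₁ ≡ u₃ × ¬ u₂ ≡ u₃
        × Adj v u₁ × Adj v u₂ × Adj v u₃
        × S u₁ ≡ true × S u₂ ≡ true × S u₃ ≡ true))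

data ReachIn (S : Subset) : V → V → Set where
  here : ∀ {v} → S v ≡ true → ReachIn S v v
  step : ∀ {u v w} → ReachIn S u v → Adj v w → S w ≡ true → ReachIn S u w

IsEdgeComponent : Subset → V → V → Set
IsEdgeComponent S u v =
  S u ≡ true × S v ≡ true × Adj u v × (∀ w → ReachIn S u w → w ≡ u ⊎ w ≡ v)

IsK2QPDS : Subset → Set
IsK2QPDS S = IsQPDS S × (∀ u → S u ≡ true → ∃[ v ] IsEdgeComponent S u v)

-- Vertices of Γ(S): components of Δ[S] that are single edges {u,v}.
Comp : Subset → Set
Comp S = Σ (V × V) λ { (u , v) → IsEdgeComponent S u v }

Type₁ Type₂ Type₃ : ∀ {S} → Comp S → Set
Type₁ ((u , v) , _) = x₁ u ≡ x₁ v
Type₂ ((u , v) , _) = x₂ u ≡ x₂ v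
Type₃ ((u , v) , _) = x₃ u ≡ x₃ v

data Walk : V → V → ℕ → Set where
  nil  : ∀ {v} → Walk v v zero
  cons : ∀ {u v w n} → Adj u v → Walk v w n → Walk u w (suc n)

_∈C_ : ∀ {S} → V → Comp S → Set
a ∈C ((u , v) , _) = a ≡ u ⊎ a ≡ v

-- Adjacency in Γ(S): the distance in Δ between the two components
-- (minimum graph distance between a vertex of one and one of the other) is 3.
ΓAdj : ∀ {S} → Comp S → Comp S → Set
ΓAdj {S} C D =
    (∃[ a ] ∃[ b ] (a ∈C C × b ∈C D × Walk a b 3))
  × (∀ a b n → a ∈C C → b ∈C D → Walk a b n → 3 ≤ n)

HasTypedTriangle : Subset → Set
HasTypedTriangle S = ∃[ C₁ ] ∃[ C₂ ] ∃[ C₃ ]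
  ( Type₁ {S} C₁ × Type₂ {S} C₂ × Type₃ {S} C₃
  × ΓAdj C₁ C₂ × ΓAdj C₁ C₃ × ΓAdj C₂ C₃)

record Aut : Set where
  field
    fun    : V → V
    inv    : V → V
    inv-l  : ∀ v → inv (fun v) ≡ v
    inv-r  : ∀ v → fun (inv v) ≡ v
    adj⇒   : ∀ u v → Adj u v → Adj (fun u) (fun v)
    adj⇐   : ∀ u v → Adj (fun u) (fun v) → Adj u v
open Aut public

IsImage : Aut → Subset → Subset → Set
IsImage φ S T = ∀ v → T (fun φ v) ≡ S v

module Submission where

-- Both sets are periodic: v lies in the set iff the residue of x₁ - q·x₂
-- modulo m is in a fixed list (S: m = 35, q = 7; T: m = 34, q = 5).  The residue
-- of a neighbour v + d depends only on the residue of v and the direction d, so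
-- every condition on the neighbourhood of a vertex reduces to a condition on
-- its residue, decided for all m residues by evaluation.  Finally S and T
-- are K₂-QPDSs with typed triangles, and S has a wedge while T has none, so
-- neither is the image of the other.

open import Defs
open import Data.Product using (_×_; ∃-syntax)
open import Relation.Nullary using (¬_)

open import Data.Nat as ℕ using (ℕ; zero; suc; NonZero; z≤n; _⊔_)
import Data.Nat.Properties as ℕP
import Data.Nat.Divisibility as ℕ∣
open import Data.Integer using (ℤ; +_; 0ℤ; ∣_∣; _+_; _-_; _*_; -_; _%ℕ_; _/ℕ_)
import Data.Integer.Properties as ℤP
open import Data.Integer.DivMod using (a≡a%ℕn+[a/ℕn]*n; n%ℕd<d)
open import Data.Integer.Divisibility.Signed using (_∣_; divides; ∣⇒∣ᵤ; ∣m∣n⇒∣m+n; ∣m⇒∣-m)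
open import Data.Integer.Tactic.RingSolver using (solve-∀)
open import Data.Bool using (Bool; true; false)
import Data.Bool.Properties as BoolP
open import Data.Product using (Σ; _,_; proj₁; proj₂)
import Data.Product.Properties as ×P
open import Data.Sum using (_⊎_; inj₁; inj₂)
open import Data.Empty using (⊥; ⊥-elim)
open import Data.List using (List; _∷_; []; upTo)
open import Data.List.Relation.Unary.All as All using (All; _∷_; [])
open import Data.List.Relation.Unary.Any as Any using (Any)
open import Data.List.Membership.Propositional using (_∈_; find; lose)
open import Data.List.Membership.Propositional.Properties using (∈-upTo⁺)
import Data.List.Membership.DecPropositional as DecMembership
open import Relation.Binary.PropositionalEquality
open import Relation.Nullary using (Dec; does)
open import Relation.Nullary.Decidable using (True; False; toWitness; toWitnessFalse; from-yes)
open import Relation.Nullary.Decidable using (¬?; _×-dec_; _⊎-dec_; _→-dec_)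
open import Axiom.UniquenessOfIdentityProofs using (module Decidable⇒UIP)

Vec3 : Set
Vec3 = ℤ × ℤ × ℤ

_⊖_ : Vec3 → Vec3 → Vec3
(a₁ , a₂ , a₃) ⊖ (b₁ , b₂ , b₃) = (a₁ - b₁ , a₂ - b₂ , a₃ - b₃)

_≟ᵛ_ : (d e : Vec3) → Dec (d ≡ e)
_≟ᵛ_ = ×P.≡-dec ℤP._≟_ (×P.≡-dec ℤP._≟_ ℤP._≟_)

open DecMembership _≟ᵛ_ using (_∈?_)

diff : V → V → Vec3
diff a b = (x₁ b - x₁ a , x₂ b - x₂ a , x₃ b - x₃ a)

adj? : ∀ a b → Dec (Adj a b)
adj? a b = diff a b ∈? dirs

adjacent : (a b : V) → {True (adj? a b)} → Adj a b
adjacent a b {p} = toWitness p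

non-adjacent : (a b : V) → {False (adj? a b)} → ¬ Adj a b
non-adjacent a b {p} = toWitnessFalse p

δ₁ δ₂ δ₃ : Vec3 → ℤ
δ₁ = proj₁
δ₂ d = proj₁ (proj₂ d)
δ₃ d = proj₂ (proj₂ d)

dirs-balanced : All (λ d → δ₁ d + δ₂ d + δ₃ d ≡ 0ℤ) dirs
dirs-balanced = refl ∷ refl ∷ refl ∷ refl ∷ refl ∷ refl ∷ []

dirs-unit : All (λ d → ∣ δ₁ d ∣ ℕ.≤ 1 × ∣ δ₂ d ∣ ℕ.≤ 1 × ∣ δ₃ d ∣ ℕ.≤ 1) dirs
dirs-unit = from-yes (All.all? (λ d → (∣ δ₁ d ∣ ℕ.≤? 1) ×-dec (∣ δ₂ d ∣ ℕ.≤? 1) ×-dec (∣ δ₃ d ∣ ℕ.≤? 1)) dirs)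

𝟎 : Vec3
𝟎 = (0ℤ , 0ℤ , 0ℤ)

dirs-opposite : All (λ d → 𝟎 ⊖ d ∈ dirs) dirs
dirs-opposite = from-yes (All.all? (λ d → 𝟎 ⊖ d ∈? dirs) dirs)

diff-⊖ : ∀ a b c → diff b c ≡ diff a c ⊖ diff a b
diff-⊖ a b c = cong₂ _,_ (rebase (x₁ a) (x₁ b) (x₁ c))
                 (cong₂ _,_ (rebase (x₂ a) (x₂ b) (x₂ c)) (rebase (x₃ a) (x₃ b) (x₃ c)))
  where
    rebase : ∀ x y z → z - y ≡ (z - x) - (y - x)
    rebase = solve-∀

diff-self : ∀ a → diff a a ≡ 𝟎
diff-self a = cong₂ _,_ (ℤP.+-inverseʳ (x₁ a)) (cong₂ _,_ (ℤP.+-inverseʳ (x₂ a)) (ℤP.+-inverseʳ (x₃ a)))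

adj-sym : ∀ {a b} → Adj a b → Adj b a
adj-sym {a} {b} ab = subst (_∈ dirs) (sym reversed) (All.lookup dirs-opposite ab)
  where
    reversed : diff b a ≡ 𝟎 ⊖ diff a b
    reversed = trans (diff-⊖ a b a) (cong (_⊖ diff a b) (diff-self a))

vertex-ext : ∀ {a b} → x₁ a ≡ x₁ b → x₂ a ≡ x₂ b → x₃ a ≡ x₃ b → a ≡ b
vertex-ext {vtx a₁ a₂ a₃ p} {vtx .a₁ .a₂ .a₃ q} refl refl refl =
  cong (vtx a₁ a₂ a₃) (Decidable⇒UIP.≡-irrelevant ℤP._≟_ p q)

diff-injective : ∀ {a b c} → diff a b ≡ diff a c → b ≡ c
diff-injective {a} e = vertex-ext (unshift (x₁ a) (cong δ₁ e)) (unshift (x₂ a) (cong δ₂ e))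
                                  (unshift (x₃ a) (cong δ₃ e))
  where
    rebuild : ∀ x y → y ≡ (y - x) + x
    rebuild = solve-∀
    unshift : ∀ x {y z} → y - x ≡ z - x → y ≡ z
    unshift x {y} {z} e = trans (rebuild x y) (trans (cong (_+ x) e) (sym (rebuild x z)))

shift : (a : V) (d : Vec3) → δ₁ d + δ₂ d + δ₃ d ≡ 0ℤ → V
shift a d balanced = vtx (x₁ a + δ₁ d) (x₂ a + δ₂ d) (x₃ a + δ₃ d)
  (trans (regroup (x₁ a) (x₂ a) (x₃ a) (δ₁ d) (δ₂ d) (δ₃ d)) (cong₂ _+_ (sum0 a) balanced))
  where
    regroup : ∀ x y z d e f → (x + d) + (y + e) + (z + f) ≡ (x + y + z) + (d + e + f)
    regroup = solve-∀

diff-shift : ∀ a d balanced → diff a (shift a d balanced) ≡ d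
diff-shift a d _ = cong₂ _,_ (cancel (x₁ a) (δ₁ d)) (cong₂ _,_ (cancel (x₂ a) (δ₂ d)) (cancel (x₃ a) (δ₃ d)))
  where
    cancel : ∀ x e → (x + e) - x ≡ e
    cancel = solve-∀

neighbour : (a : V) → ∀ {d} → d ∈ dirs → Σ V λ b → Adj a b × diff a b ≡ d
neighbour a {d} p = b , subst (_∈ dirs) (sym moved) p , moved
  where
    balanced : δ₁ d + δ₂ d + δ₃ d ≡ 0ℤ
    balanced = All.lookup dirs-balanced p
    b : V
    b = shift a d balanced
    moved : diff a b ≡ d
    moved = diff-shift a d balanced

module Lipschitz (f : V → ℤ) (edge-bound : ∀ {a b} → Adj a b → ∣ f b - f a ∣ ℕ.≤ 1) where
  walk-bound : ∀ {a b n} → Walk a b n → ∣ f b - f a ∣ ℕ.≤ n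
  walk-bound {a} nil rewrite ℤP.+-inverseʳ (f a) = z≤n
  walk-bound {a} {b} (cons {v = v} {n = n} av vb) = begin
    ∣ f b - f a ∣                   ≡⟨ cong ∣_∣ (sym (ℤP.+-minus-telescope (f b) (f v) (f a))) ⟩
    ∣ (f b - f v) + (f v - f a) ∣   ≤⟨ ℤP.∣i+j∣≤∣i∣+∣j∣ (f b - f v) (f v - f a) ⟩
    ∣ f b - f v ∣ ℕ.+ ∣ f v - f a ∣ ≤⟨ ℕP.+-mono-≤ (walk-bound vb) (edge-bound av) ⟩
    n ℕ.+ 1                         ≡⟨ ℕP.+-comm n 1 ⟩
    suc n                           ∎
    where open ℕP.≤-Reasoning

hexDist : V → V → ℕ
hexDist a b = ∣ x₁ b - x₁ a ∣ ⊔ ∣ x₂ b - x₂ a ∣ ⊔ ∣ x₃ b - x₃ a ∣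

walk-length : ∀ {a b n} → Walk a b n → hexDist a b ℕ.≤ n
walk-length w = ℕP.⊔-lub (ℕP.⊔-lub (Lipschitz.walk-bound x₁ (λ ab → proj₁ (unit ab)) w)
                                    (Lipschitz.walk-bound x₂ (λ ab → proj₁ (proj₂ (unit ab))) w))
                         (Lipschitz.walk-bound x₃ (λ ab → proj₂ (proj₂ (unit ab))) w)
  where
    unit : ∀ {d} → d ∈ dirs → ∣ δ₁ d ∣ ℕ.≤ 1 × ∣ δ₂ d ∣ ℕ.≤ 1 × ∣ δ₃ d ∣ ℕ.≤ 1
    unit = All.lookup dirs-unit

ends : ∀ {Y} → Comp Y → List V
ends ((u , v) , _) = u ∷ v ∷ []

ends-∈ : ∀ {Y} (C : Comp Y) {a} → a ∈C C → a ∈ ends C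
ends-∈ _ (inj₁ refl) = Any.here refl
ends-∈ _ (inj₂ refl) = Any.there (Any.here refl)

Separated : ∀ {Y} → Comp Y → Comp Y → Set
Separated C D = All (λ a → All (λ b → 3 ℕ.≤ hexDist a b) (ends D)) (ends C)

separated? : ∀ {Y} (C D : Comp Y) → Dec (Separated C D)
separated? C D = All.all? (λ a → All.all? (λ b → 3 ℕ.≤? hexDist a b) (ends D)) (ends C)

Γ-adjacent : ∀ {Y} (C D : Comp Y) → ∃[ a ] ∃[ b ] (a ∈C C × b ∈C D × Walk a b 3) →
             Separated C D → ΓAdj C D
Γ-adjacent C D link apart = link , λ a b n a∈ b∈ w →
  ℕP.≤-trans (All.lookup (All.lookup apart (ends-∈ C a∈)) (ends-∈ D b∈)) (walk-length w)

module Residues (m : ℕ) .{{_ : NonZero m}} where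
  infix 4 _≈_
  _≈_ : ℤ → ℤ → Set
  i ≈ j = + m ∣ i - j

  ≈-trans : ∀ {i j k} → i ≈ j → j ≈ k → i ≈ k
  ≈-trans {i} {j} {k} p q = subst (+ m ∣_) (ℤP.+-minus-telescope i j k) (∣m∣n⇒∣m+n p q)

  ≈-sym : ∀ {i j} → i ≈ j → j ≈ i
  ≈-sym {i} {j} p = subst (+ m ∣_) (swap i j) (∣m⇒∣-m p)
    where
      swap : ∀ i j → - (i - j) ≡ j - i
      swap = solve-∀

  ≈-+ʳ : ∀ {i j} k → i ≈ j → i + k ≈ j + k
  ≈-+ʳ {i} {j} k p = subst (+ m ∣_) (sym (cancel i j k)) p
    where
      cancel : ∀ i j k → (i + k) - (j + k) ≡ i - j
      cancel = solve-∀

  residue-≈ : ∀ z → z ≈ + (z %ℕ m)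
  residue-≈ z = divides (z /ℕ m) (trans (cong (_- r) (a≡a%ℕn+[a/ℕn]*n z m)) (cancel r ((z /ℕ m) * + m)))
    where
      r : ℤ
      r = + (z %ℕ m)
      cancel : ∀ x y → (x + y) - x ≡ y
      cancel = solve-∀

  -- Distinct residues are never congruent: their difference is a multiple of m below m.
  residue-unique : ∀ {r s} → r ℕ.< m → s ℕ.< m → + r ≈ + s → r ≡ s
  residue-unique {r} {s} r<m s<m r≈s =
    ℤP.+-injective (ℤP.i-j≡0⇒i≡j (+ r) (+ s) (ℤP.∣i∣≡0⇒i≡0 (small-multiple (∣⇒∣ᵤ r≈s) gap)))
    where
      small-multiple : ∀ {n} → m ℕ∣.∣ n → n ℕ.< m → n ≡ 0
      small-multiple {zero}  _     _   = refl
      small-multiple {suc n} m∣n n<m = ⊥-elim (ℕP.<⇒≱ n<m (ℕ∣.∣⇒≤ m∣n))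
      gap : ∣ + r - + s ∣ ℕ.< m
      gap with ℕP.≤-total r s
      ... | inj₁ r≤s rewrite ℤP.[+m]-[+n]≡m⊖n r s | ℤP.∣⊖∣-≤ r≤s = ℕP.≤-<-trans (ℕP.m∸n≤m s r) s<m
      ... | inj₂ s≤r rewrite ℤP.[+m]-[+n]≡m⊖n r s | ℤP.∣m⊖n∣≡∣n⊖m∣ r s | ℤP.∣⊖∣-≤ s≤r =
        ℕP.≤-<-trans (ℕP.m∸n≤m r s) r<m

  %ℕ-cong : ∀ {i j} → i ≈ j → i %ℕ m ≡ j %ℕ m
  %ℕ-cong {i} {j} i≈j = residue-unique (n%ℕd<d i m) (n%ℕd<d j m)
    (≈-trans {+ (i %ℕ m)} {i} (≈-sym {i} (residue-≈ i)) (≈-trans {i} {j} i≈j (residue-≈ j)))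

Neighbour∈ : Subset → V → V → Set
Neighbour∈ Y v u = Adj v u × Y u ≡ true

UniqueNeighbour : Subset → V → Set
UniqueNeighbour Y v = ∃[ u ] (Neighbour∈ Y v u × ∀ w → Neighbour∈ Y v w → w ≡ u)

module Matching {Y : Subset} (unique : ∀ u → Y u ≡ true → UniqueNeighbour Y u) where
  only-neighbour : ∀ {u v w} → Y u ≡ true → Neighbour∈ Y u v → Neighbour∈ Y u w → w ≡ v
  only-neighbour {u} {v} {w} hu uv uw with unique u hu
  ... | _ , _ , only = trans (only w uw) (sym (only v uv))

  edge-component : ∀ {u v} → Y u ≡ true → Neighbour∈ Y u v → IsEdgeComponent Y u v
  edge-component {u} {v} hu (uv , hv) = hu , hv , uv , reach
    where
      reach : ∀ w → ReachIn Y u w → w ≡ u ⊎ w ≡ v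
      reach _ (here _) = inj₁ refl
      reach w (step {v = x} ρ xw hw) with reach x ρ
      ... | inj₁ refl = inj₂ (only-neighbour hu (uv , hv) (xw , hw))
      ... | inj₂ refl = inj₁ (only-neighbour hv (adj-sym {u} {v} uv , hu) (xw , hw))

  components : ∀ u → Y u ≡ true → ∃[ v ] IsEdgeComponent Y u v
  components u hu = let (v , uv , _) = unique u hu in v , edge-component hu uv

-- A wedge of Y: a vertex v ∉ Y with two distinct, non-adjacent neighbours
-- u₁, u₂ ∈ Y that have a common neighbour w adjacent to v; i.e. u₁ and u₂ lie
-- at angle 120° around v.  Being defined by adjacency alone, it is preserved
-- by automorphisms.
HasWedge : Subset → Set
HasWedge Y = ∃[ v ] ∃[ u₁ ] ∃[ u₂ ] ∃[ w ]
  ( Y v ≡ false × Neighbour∈ Y v u₁ × Neighbour∈ Y v u₂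
  × Adj v w × Adj w u₁ × Adj w u₂ × ¬ Adj u₁ u₂ × ¬ u₁ ≡ u₂)

-- The shape of a wedge seen from its centre, in terms of the directions d₁, d₂
-- towards u₁, u₂ (and e towards w).
WedgeDirs : Vec3 → Vec3 → Set
WedgeDirs d₁ d₂ = ¬ d₁ ≡ d₂ × ¬ d₂ ⊖ d₁ ∈ dirs × Any (λ e → d₁ ⊖ e ∈ dirs × d₂ ⊖ e ∈ dirs) dirs

wedgeDirs? : ∀ d₁ d₂ → Dec (WedgeDirs d₁ d₂)
wedgeDirs? d₁ d₂ = ¬? (d₁ ≟ᵛ d₂) ×-dec ¬? (d₂ ⊖ d₁ ∈? dirs)
                   ×-dec Any.any? (λ e → (d₁ ⊖ e ∈? dirs) ×-dec (d₂ ⊖ e ∈? dirs)) dirs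

wedge-directions : ∀ {v u₁ u₂ w} → Adj v w → Adj w u₁ → Adj w u₂ → ¬ Adj u₁ u₂ → ¬ u₁ ≡ u₂ →
                   WedgeDirs (diff v u₁) (diff v u₂)
wedge-directions {v} {u₁} {u₂} {w} vw wu₁ wu₂ not-adj distinct =
    (λ e → distinct (diff-injective {v} e))
  , (λ p → not-adj (subst (_∈ dirs) (sym (diff-⊖ v u₁ u₂)) p))
  , lose vw (subst (_∈ dirs) (diff-⊖ v w u₁) wu₁ , subst (_∈ dirs) (diff-⊖ v w u₂) wu₂)

wedge-image : ∀ φ {Y Z} → IsImage φ Y Z → HasWedge Y → HasWedge Z
wedge-image φ img (v , u₁ , u₂ , w , hv , (vu₁ , hu₁) , (vu₂ , hu₂) , vw , wu₁ , wu₂ , not-adj , distinct) =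
  fun φ v , fun φ u₁ , fun φ u₂ , fun φ w ,
  trans (img v) hv , (adj⇒ φ _ _ vu₁ , trans (img u₁) hu₁) , (adj⇒ φ _ _ vu₂ , trans (img u₂) hu₂) ,
  adj⇒ φ _ _ vw , adj⇒ φ _ _ wu₁ , adj⇒ φ _ _ wu₂ ,
  (λ a → not-adj (adj⇐ φ _ _ a)) ,
  (λ e → distinct (trans (sym (inv-l φ u₁)) (trans (cong (inv φ) e) (inv-l φ u₂))))

inverse : Aut → Aut
inverse φ = record
  { fun = inv φ ; inv = fun φ ; inv-l = inv-r φ ; inv-r = inv-l φ
  ; adj⇒ = λ u v a → adj⇐ φ _ _ (subst₂ Adj (sym (inv-r φ u)) (sym (inv-r φ v)) a)
  ; adj⇐ = λ u v a → subst₂ Adj (inv-r φ u) (inv-r φ v) (adj⇒ φ _ _ a) }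

image-inverse : ∀ φ {Y Z} → IsImage φ Y Z → IsImage (inverse φ) Z Y
image-inverse φ {Y} {Z} img v = trans (sym (img (inv φ v))) (cong Z (inv-r φ v))

wedge-distinguishes : ∀ {Y Z} → HasWedge Y → ¬ HasWedge Z →
                      ¬ (∃[ φ ] IsImage φ Y Z) × ¬ (∃[ φ ] IsImage φ Z Y)
wedge-distinguishes wedge no-wedge =
  (λ (φ , img) → no-wedge (wedge-image φ img wedge)) ,
  (λ (φ , img) → no-wedge (wedge-image (inverse φ) (image-inverse φ img) wedge))

module Periodic (m : ℕ) .{{_ : NonZero m}} (q : ℤ) (members : List ℕ) where
  open Residues m

  form : Vec3 → ℤ
  form d = δ₁ d - q * δ₂ d

  residue : V → ℕ
  residue v = form (x₁ v , x₂ v , x₃ v) %ℕ m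

  colour : ℕ → Bool
  colour r = does (DecMembership._∈?_ ℕP._≟_ r members)

  X : Subset
  X v = colour (residue v)

  _⊕_ : ℕ → Vec3 → ℕ
  r ⊕ d = (+ r + form d) %ℕ m

  residue-diff : ∀ a b → residue b ≡ residue a ⊕ diff a b
  residue-diff a b = trans (cong (_%ℕ m) linear)
    (%ℕ-cong {form pa + increment} (≈-+ʳ {form pa} increment (residue-≈ (form pa))))
    where
      pa : Vec3
      pa = (x₁ a , x₂ a , x₃ a)
      increment : ℤ
      increment = form (diff a b)
      expand : ∀ k a₁ a₂ b₁ b₂ → b₁ - k * b₂ ≡ (a₁ - k * a₂) + ((b₁ - a₁) - k * (b₂ - a₂))
      expand = solve-∀
      linear : form (x₁ b , x₂ b , x₃ b) ≡ form pa + increment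
      linear = expand q (x₁ a) (x₂ a) (x₁ b) (x₂ b)

  X-from : ∀ v u → X u ≡ colour (residue v ⊕ diff v u)
  X-from v u = cong colour (residue-diff v u)

  Towards : ℕ → Vec3 → Set
  Towards r d = colour (r ⊕ d) ≡ true

  towards? : ∀ r d → Dec (Towards r d)
  towards? r d = colour (r ⊕ d) BoolP.≟ true

  Outside : ℕ → Set
  Outside r = colour r ≡ false

  Dominated AtMostTwo Matched LocallyK2QPDS : ℕ → Set
  Dominated r = Outside r → Any (Towards r) dirs
  AtMostTwo r = Outside r → All (λ d₁ → All (λ d₂ → All (λ d₃ →
    Towards r d₁ → Towards r d₂ → Towards r d₃ → d₁ ≡ d₂ ⊎ d₁ ≡ d₃ ⊎ d₂ ≡ d₃) dirs) dirs) dirs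
  Matched r = colour r ≡ true → Any (λ d → Towards r d × All (λ e → Towards r e → e ≡ d) dirs) dirs
  LocallyK2QPDS r = Dominated r × AtMostTwo r × Matched r

  locallyK2QPDS? : ∀ r → Dec (LocallyK2QPDS r)
  locallyK2QPDS? r = dominated? ×-dec atMostTwo? ×-dec matched?
    where
      outside? : Dec (Outside r)
      outside? = colour r BoolP.≟ false
      dominated? : Dec (Dominated r)
      dominated? = outside? →-dec Any.any? (towards? r) dirs
      atMostTwo? : Dec (AtMostTwo r)
      atMostTwo? = outside? →-dec All.all? (λ d₁ → All.all? (λ d₂ → All.all? (λ d₃ →
        towards? r d₁ →-dec towards? r d₂ →-dec towards? r d₃ →-dec
        ((d₁ ≟ᵛ d₂) ⊎-dec (d₁ ≟ᵛ d₃) ⊎-dec (d₂ ≟ᵛ d₃))) dirs) dirs) dirs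
      matched? : Dec (Matched r)
      matched? = (colour r BoolP.≟ true) →-dec
        Any.any? (λ d → towards? r d ×-dec All.all? (λ e → towards? r e →-dec (e ≟ᵛ d)) dirs) dirs

  WedgeFree : ℕ → Set
  WedgeFree r = Outside r → All (λ d₁ → All (λ d₂ → Towards r d₁ → Towards r d₂ → ¬ WedgeDirs d₁ d₂) dirs) dirs

  wedgeFree? : ∀ r → Dec (WedgeFree r)
  wedgeFree? r = (colour r BoolP.≟ false) →-dec All.all? (λ d₁ → All.all? (λ d₂ →
    towards? r d₁ →-dec towards? r d₂ →-dec ¬? (wedgeDirs? d₁ d₂)) dirs) dirs

  everywhere : ∀ {P : ℕ → Set} → All P (upTo m) → ∀ v → P (residue v)
  everywhere checked v = All.lookup checked (∈-upTo⁺ (n%ℕd<d (form (x₁ v , x₂ v , x₃ v)) m))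

  inside-towards : ∀ v u → X u ≡ true → Towards (residue v) (diff v u)
  inside-towards v u hu = trans (sym (X-from v u)) hu

  towards-inside : ∀ v u → Towards (residue v) (diff v u) → X u ≡ true
  towards-inside v u t = trans (X-from v u) t

  neighbour-towards : ∀ v {d} → d ∈ dirs → Towards (residue v) d → Σ V (Neighbour∈ X v)
  neighbour-towards v d∈ t with neighbour v d∈
  ... | u , vu , refl = u , vu , towards-inside v u t

  module _ (checked : All LocallyK2QPDS (upTo m)) where
    private
      local : ∀ v → LocallyK2QPDS (residue v)
      local = everywhere checked

    dominating : ∀ v → Outside (residue v) → ∃[ u ] (Adj v u × X u ≡ true)
    dominating v out = let (_ , d∈ , t) = find (proj₁ (local v) out) in neighbour-towards v d∈ t

    no-three : ∀ v → Outside (residue v) → ∀ {u₁ u₂ u₃} → ¬ u₁ ≡ u₂ → ¬ u₁ ≡ u₃ → ¬ u₂ ≡ u₃ →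
               Neighbour∈ X v u₁ → Neighbour∈ X v u₂ → Neighbour∈ X v u₃ → ⊥
    no-three v out {u₁} {u₂} {u₃} n₁₂ n₁₃ n₂₃ (vu₁ , h₁) (vu₂ , h₂) (vu₃ , h₃)
      = coincide (All.lookup (All.lookup (All.lookup (proj₁ (proj₂ (local v)) out) vu₁) vu₂) vu₃
                   (inside-towards v u₁ h₁) (inside-towards v u₂ h₂) (inside-towards v u₃ h₃))
      where
        coincide : diff v u₁ ≡ diff v u₂ ⊎ diff v u₁ ≡ diff v u₃ ⊎ diff v u₂ ≡ diff v u₃ → ⊥
        coincide (inj₁ e)        = n₁₂ (diff-injective {v} e)
        coincide (inj₂ (inj₁ e)) = n₁₃ (diff-injective {v} e)
        coincide (inj₂ (inj₂ e)) = n₂₃ (diff-injective {v} e)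

    matched : ∀ u → X u ≡ true → UniqueNeighbour X u
    matched u hu = let (d , d∈ , t , only) = find (proj₂ (proj₂ (local u)) hu)
                       (v , uv , uv≡d) = neighbour u d∈
                   in v , (uv , towards-inside u v (subst (Towards (residue u)) (sym uv≡d) t)) ,
                      λ w (uw , hw) → diff-injective {u}
                        (trans (All.lookup only uw (inside-towards u w hw)) (sym uv≡d))

    component : ∀ u v {_ : True (adj? u v)} → X u ≡ true → X v ≡ true → Comp X
    component u v {uv} hu hv = (u , v) , Matching.edge-component matched hu (toWitness uv , hv)

    K2QPDS-from-local : IsK2QPDS X
    K2QPDS-from-local =
      (λ v out → dominating v out ,
        λ (_ , _ , _ , n₁₂ , n₁₃ , n₂₃ , vu₁ , vu₂ , vu₃ , h₁ , h₂ , h₃) →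
          no-three v out n₁₂ n₁₃ n₂₃ (vu₁ , h₁) (vu₂ , h₂) (vu₃ , h₃)) ,
      Matching.components matched

  wedge-free : All WedgeFree (upTo m) → ¬ HasWedge X
  wedge-free checked (v , u₁ , u₂ , w , out , (vu₁ , h₁) , (vu₂ , h₂) , vw , wu₁ , wu₂ , not-adj , distinct) =
    All.lookup (All.lookup (everywhere checked v out) vu₁) vu₂
      (inside-towards v u₁ h₁) (inside-towards v u₂ h₂)
      (wedge-directions {v} {u₁} {u₂} {w} vw wu₁ wu₂ not-adj distinct)

pt : ℤ → ℤ → V
pt a b = vtx a b (- (a + b)) (ℤP.+-inverseʳ (a + b))

joined : ∀ {Y} (C D : Comp Y) (a p q b : V) → a ∈C C → b ∈C D →
         {_ : True (adj? a p)} {_ : True (adj? p q)} {_ : True (adj? q b)} {_ : True (separated? C D)} →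
         ΓAdj C D
joined C D a p q b a∈ b∈ {ap} {pq} {qb} {sep} =
  Γ-adjacent C D (a , b , a∈ , b∈ , walk) (toWitness sep)
  where
    walk : Walk a b 3
    walk = cons {a} {p} (toWitness ap) (cons {p} {q} (toWitness pq) (cons {q} {b} (toWitness qb) nil))

module S = Periodic 35 (+ 7) (0 ∷ 5 ∷ 13 ∷ 17 ∷ 18 ∷ 23 ∷ 28 ∷ 30 ∷ [])
module T = Periodic 34 (+ 5) (0 ∷ 3 ∷ 12 ∷ 13 ∷ 15 ∷ 21 ∷ 29 ∷ 31 ∷ [])

S-local : All S.LocallyK2QPDS (upTo 35)
S-local = from-yes (All.all? S.locallyK2QPDS? (upTo 35))

T-local : All T.LocallyK2QPDS (upTo 34)
T-local = from-yes (All.all? T.locallyK2QPDS? (upTo 34))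

T-wedge-free : All T.WedgeFree (upTo 34)
T-wedge-free = from-yes (All.all? T.wedgeFree? (upTo 34))

S-triangle : HasTypedTriangle S.X
S-triangle = C₁ , C₂ , C₃ , refl , refl , refl ,
    joined C₁ C₂ (pt (+ 0) (+ 0)) (pt (- + 1) (+ 1)) (pt (- + 2) (+ 2)) (pt (- + 3) (+ 2)) (inj₁ refl) (inj₂ refl) ,
    joined C₁ C₃ (pt (+ 0) (+ 0)) (pt (- + 1) (+ 0)) (pt (- + 2) (+ 0)) (pt (- + 2) (- + 1)) (inj₁ refl) (inj₁ refl) ,
    joined C₂ C₃ (pt (- + 4) (+ 2)) (pt (- + 3) (+ 1)) (pt (- + 2) (+ 0)) (pt (- + 2) (- + 1)) (inj₁ refl) (inj₁ refl)
  where
    edge : ∀ u v {_ : True (adj? u v)} → S.X u ≡ true → S.X v ≡ true → Comp S.X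
    edge = S.component S-local
    C₁ C₂ C₃ : Comp S.X
    C₁ = edge (pt (+ 0) (+ 0)) (pt (+ 0) (+ 1)) refl refl
    C₂ = edge (pt (- + 4) (+ 2)) (pt (- + 3) (+ 2)) refl refl
    C₃ = edge (pt (- + 2) (- + 1)) (pt (- + 1) (- + 2)) refl refl

T-triangle : HasTypedTriangle T.X
T-triangle = C₁ , C₂ , C₃ , refl , refl , refl ,
    joined C₁ C₂ (pt (+ 0) (+ 1)) (pt (- + 1) (+ 2)) (pt (- + 2) (+ 3)) (pt (- + 2) (+ 4)) (inj₂ refl) (inj₁ refl) ,
    joined C₁ C₃ (pt (+ 0) (+ 0)) (pt (- + 1) (+ 1)) (pt (- + 2) (+ 2)) (pt (- + 3) (+ 2)) (inj₁ refl) (inj₂ refl) ,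
    joined C₂ C₃ (pt (- + 2) (+ 4)) (pt (- + 3) (+ 4)) (pt (- + 4) (+ 4)) (pt (- + 4) (+ 3)) (inj₁ refl) (inj₁ refl)
  where
    edge : ∀ u v {_ : True (adj? u v)} → T.X u ≡ true → T.X v ≡ true → Comp T.X
    edge = T.component T-local
    C₁ C₂ C₃ : Comp T.X
    C₁ = edge (pt (+ 0) (+ 0)) (pt (+ 0) (+ 1)) refl refl
    C₂ = edge (pt (- + 2) (+ 4)) (pt (- + 1) (+ 4)) refl refl
    C₃ = edge (pt (- + 4) (+ 3)) (pt (- + 3) (+ 2)) refl refl

S-wedge : HasWedge S.X
S-wedge = v , u₁ , u₂ , w , refl , (adjacent v u₁ , refl) , (adjacent v u₂ , refl) ,
          adjacent v w , adjacent w u₁ , adjacent w u₂ , non-adjacent u₁ u₂ , λ e → x₁-differ (cong x₁ e)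
  where
    v u₁ u₂ w : V
    v = pt (- + 5) (- + 3)
    u₁ = pt (- + 4) (- + 3)
    u₂ = pt (- + 5) (- + 4)
    w = pt (- + 4) (- + 4)
    x₁-differ : ¬ x₁ u₁ ≡ x₁ u₂
    x₁-differ ()

theorem13 : ∃[ S ] ∃[ T ]
    ( IsK2QPDS S × HasTypedTriangle S
    × IsK2QPDS T × HasTypedTriangle T
    × ¬ (∃[ φ ] IsImage φ S T) × ¬ (∃[ φ ] IsImage φ T S))
theorem13 = S.X , T.X ,
  S.K2QPDS-from-local S-local , S-triangle ,
  T.K2QPDS-from-local T-local , T-triangle ,
  wedge-distinguishes S-wedge (T.wedge-free T-wedge-free)
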